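{- Let $m,q,k\ge 1$, let $d$ be a positive divisor of $m$, and let $s$ be a linear sequence with $(s)\in\mathcal{C}^{(d)}(m,q,k)$. Then $\mathrm{BWT}(s)$ has the form $a_1^{\,d}a_2^{\,d}\cdots a_r^{\,d}$ where $a_1a_2\cdots a_r\in(\mathcal{P}_{m/d,q})^{q^{k-1}}\cap\mathcal{N}$.
   Context: Let $\Omega=\{0,1,\ldots,q-1\}$ with the usual order; a $k$-mer is an element of $\Omega^k$. For $s=a_1\ldots a_n$, $\rho(a_1\ldots a_n)=a_na_1\ldots a_{n-1}$; the cyclic sequence $(s)$ is the set of rotations of $s$. The number of occurrences of a $k$-mer $y$ in $(a_1\ldots a_n)$ is the number of $i\in\{1,\ldots,n\}$ with $a_i\cdots a_{i+k-1}=y$, indices modulo $n$ (positions may be reused if $k>n$). A cyclic multi de Bruijn sequence with parameters $(m,q,k)$ is a cyclic sequence over $\Omega$ in which every $k$-mer occurs exactly $m$ times. The order of $(s)$, $|s|=n$, is the largest positive divisor $d$ of $n$ with $\rho^{n/d}(s)=s$; $\mathcal{C}^{(d)}(m,q,k)$ is the set of cyclic multi de Bruijn sequences with parameters $(m,q,k)$ of order $d$. Burrows–Wheeler Transform: for $s\in\Omega^n$, sort the $n$ rotations $\rho^0(s),\ldots,\rho^{n-1}(s)$ (with repetitions) lexicographically as rows of an $n\times n$ table; $\mathrm{BWT}(s)$ is the last column read top to bottom. $a^d$ for a letter $a$ is $d$ copies of $a$. $\mathcal{P}_{m',q}$ is the set of words of length $m'q$ over $\Omega$ in which each symbol occurs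 exactly $m'$ times; $(\mathcal{P}_{m',q})^{q^{k-1}}$ is the set of concatenations of $q^{k-1}$ words from $\mathcal{P}_{m',q}$. $\mathcal{N}$ is the set of nonempty words $w$ over $\Omega$ that are not of the form $b_1^{\,i}b_2^{\,i}\cdots b_j^{\,i}$ (letters $b_1,\ldots,b_j$) for any $i>1$. -}

module Defs where

open import Data.Nat using (ℕ; zero; suc; _+_; _*_; _∸_; _≤_; _<_)
open import Data.Fin using (Fin)
import Data.Fin as Fin
import Data.Fin.Properties as FinP
open import Data.List using (List; []; _∷_; _++_; take; drop; length; concat; concatMap;
  replicate; filter; map; upTo; reverse; [_])
import Data.List.Properties as ListP
open import Data.Vec using (Vec; toList)
open import Data.List.Relation.Unary.All using (All)
open import Data.Product using (Σ; ∃; _×_)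
open import Relation.Nullary using (¬_)
open import Relation.Binary.PropositionalEquality using (_≡_; _≢_)
import Data.List.Relation.Binary.Lex.NonStrict as Lex
import Data.List.Sort as Sort

Word : ℕ → Set
Word q = List (Fin q)

-- ρ(a₁…aₙ) = aₙ a₁ … aₙ₋₁  (right rotation; ρ [] = [])
ρ : {A : Set} → List A → List A
ρ s = drop (length s ∸ 1) s ++ take (length s ∸ 1) s

ρ^ : {A : Set} → ℕ → List A → List A
ρ^ zero    s = s
ρ^ (suc c) s = ρ (ρ^ c s)

-- The cyclic k-window a_{i+1} … a_{i+k} (0-based start i), indices taken
-- modulo n = length s (positions reused when k > n).
window : {A : Set} → List A → ℕ → ℕ → List A
window s k i = take k (concat (replicate (suc k) (drop i s ++ take i s)))

occ : {q : ℕ} → Word q → (k : ℕ) → Vec (Fin q) k → ℕ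
occ {q} s k y =
  length (filter (λ i → ListP.≡-dec Fin._≟_ (window s k i) (toList y)) (upTo (length s)))

IsMultiDeBruijn : (m q k : ℕ) → Word q → Set
IsMultiDeBruijn m q k s = (y : Vec (Fin q) k) → occ s k y ≡ m

RotInvariantDivisor : {A : Set} → List A → ℕ → Set
RotInvariantDivisor s d = 0 < d × Σ ℕ (λ c → length s ≡ c * d × ρ^ c s ≡ s)

IsOrder : {A : Set} → List A → ℕ → Set
IsOrder s d = RotInvariantDivisor s d × ((e : ℕ) → RotInvariantDivisor s e → e ≤ d)

InC : (d m q k : ℕ) → Word q → Set
InC d m q k s = IsMultiDeBruijn m q k s × IsOrder s d

lexOrder : (q : ℕ) → _
lexOrder q = Lex.≤-decTotalOrder (FinP.≤-decTotalOrder q)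

sortWords : (q : ℕ) → List (Word q) → List (Word q)
sortWords q = Sort.sort (lexOrder q)

lastL : {A : Set} → List A → List A
lastL s = take 1 (reverse s)

BWT : {q : ℕ} → Word q → Word q
BWT {q} s = concatMap lastL (sortWords q (map (λ i → ρ^ i s) (upTo (length s))))

countL : {q : ℕ} → Fin q → Word q → ℕ
countL a w = length (filter (λ b → b Fin.≟ a) w)

InP : (m' q : ℕ) → Word q → Set
InP m' q w = length w ≡ m' * q × ((a : Fin q) → countL a w ≡ m')

InPPow : (m' q r : ℕ) → Word q → Set
InPPow m' q r w = Σ (Vec (Word q) r) (λ ws → All (InP m' q) (toList ws) × concat (toList ws) ≡ w)

blowUp : {A : Set} → ℕ → List A → List A
blowUp i bs = concatMap (replicate i) bs

InN : {q : ℕ} → Word q → Set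
InN {q} w = w ≢ [] × ¬ (Σ ℕ (λ i → 1 < i × Σ (Word q) (λ bs → w ≡ blowUp i bs)))

module Submission where

-- Let |s| = n = c·d with ρ^c s = s.  The n rotations sorted by the BWT are d copies of the
-- c rotations ρ^0 s, …, ρ^(c-1) s, which are pairwise distinct since c is the least period
-- of s (periods are closed under gcd, and d is the largest rotation-invariant divisor).
-- Sorting d copies repeats every row d times, so BWT(s) = column^d for the last column of
-- the sorted list L of the c distinct rotations.
--
-- column ∈ 𝒩: the LF-mapping computes the rank of ρ x in L from the last column.  If the
-- column were a blow-up b₁^i ⋯ b_j^i with i > 1, ranks would be preserved mod i along the
-- single ρ-orbit L, yet L has rows of rank 0 and 1.
--
-- column ∈ (𝒫_{m/d,q})^{q^{k-1}}: grouping the sorted rows by their first k-1 cyclic letters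
-- cuts the column into q^{k-1} blocks, one per (k-1)-mer y.  The occurrences of a letter a
-- in block y are the rows whose k-window is a y; every window of s at a position is the
-- window of a rotation, so there are occ(a y)/d = m/d of them.

open import Defs

import Algebra.Properties.CommutativeSemigroup as CommutativeSemigroupProperties
open import Data.Empty using (⊥-elim)
open import Data.Fin using (Fin)
import Data.Fin as Fin
import Data.Fin.Properties as FinP
open import Data.Nat using (ℕ; zero; suc; _+_; _*_; _∸_; _≤_; _<_; _^_; z≤n; s≤s; NonZero; >-nonZero)
open import Data.Nat.Properties
open import Data.Nat.DivMod using (_/_; _%_; [m+kn]%n≡m%n; m*n/n≡m)
open import Data.Nat.Divisibility using (_∣_; ∣⇒≤; quotient)
open import Data.Nat.GCD using (gcd; gcd-GCD; gcd[m,n]∣m; gcd[m,n]∣n; module Bézout)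
open import Data.Nat.ListAction using (sum)
open import Data.Product using (Σ; _×_; _,_; proj₁; proj₂)
open import Data.Sum using (_⊎_; inj₁; inj₂)
open import Data.Unit using (tt)
open import Data.Vec using (Vec; toList)
import Data.Vec as Vec
open import Function using (_∘_; id)
open import Relation.Binary.Bundles using (DecTotalOrder)
open import Relation.Binary.PropositionalEquality using (_≡_; _≢_; refl; sym; trans; cong; cong₂; subst; module ≡-Reasoning)
open import Relation.Nullary using (¬_; Dec; yes; no)
open import Relation.Nullary.Decidable using (_⊎-dec_; _×-dec_; ¬?)
open import Relation.Unary using (Decidable)

open import Data.List using (List; []; _∷_; _++_; _∷ʳ_; [_]; map; concat; concatMap; replicate; reverse; filter;
  length; take; drop; applyUpTo; upTo; downFrom; allFin)
open import Data.List.Base using (initLast; _∷ʳ′_)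
open import Data.List.Properties using (≡-dec; length-++; length-map; length-take; length-replicate; length-tabulate;
  length-applyUpTo; ++-assoc; ++-identityʳ; ∷-injective; ∷ʳ-injective; take++drop≡id; reverse-++; reverse-upTo;
  concatMap-++; map-cong; map-replicate; map-tabulate; map-upTo; map-applyUpTo; applyUpTo-∷ʳ;
  filter-++; filter-none; filter-all; filter-accept; filter-reject)
open import Data.List.Membership.Propositional using (_∈_)
open import Data.List.Membership.Propositional.Properties using (∈-applyUpTo⁻; ∈-map⁺; ∈-∃++; ∈-insert; ∈-concat⁺′; ∈-allFin)
open import Data.List.Relation.Unary.Any using (here; there)
open import Data.List.Relation.Unary.All using (All; []; _∷_)
import Data.List.Relation.Unary.All as All
import Data.List.Relation.Unary.All.Properties as AllP
open import Data.List.Relation.Unary.All.Properties using (all-upTo)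
open import Data.List.Relation.Unary.AllPairs using (AllPairs; []; _∷_)
import Data.List.Relation.Unary.AllPairs as AllPairs
import Data.List.Relation.Unary.AllPairs.Properties as AllPairsP
open import Data.List.Relation.Binary.Lex.Core using (base; halt; this; next)
open import Data.List.Relation.Binary.Pointwise using (Pointwise-≡⇒≡)
import Data.List.Relation.Binary.Pointwise as PW
open import Data.List.Relation.Binary.Permutation.Propositional
  using (_↭_; prep; swap; ↭-refl; ↭-sym; ↭-trans; ↭⇒↭ₛ; module PermutationReasoning)
  renaming (refl to ↭-refl′; trans to ↭-trans′)
open import Data.List.Relation.Binary.Permutation.Propositional.Properties
  using (↭-length; ↭-reverse; filter-↭; ++⁺ˡ; shifts; ∷↭∷ʳ; map⁺; All-resp-↭; ∈-resp-↭)
import Data.List.Relation.Binary.Permutation.Homogeneous as Homo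
import Data.List.Sort as Sort
open import Data.List.Relation.Unary.Sorted.TotalOrder.Properties using (↗↭↗⇒≋; AllPairs⇒Sorted; Sorted⇒AllPairs)

count : {A : Set} {P : A → Set} → Decidable P → List A → ℕ
count P? xs = length (filter P? xs)

module _ {A : Set} {P : A → Set} (P? : Decidable P) where

  count-++ : ∀ xs ys → count P? (xs ++ ys) ≡ count P? xs + count P? ys
  count-++ xs ys = trans (cong length (filter-++ P? xs ys)) (length-++ (filter P? xs))

  count-↭ : ∀ {xs ys} → xs ↭ ys → count P? xs ≡ count P? ys
  count-↭ p = ↭-length (filter-↭ P? p)

  count-none : ∀ {xs} → All (λ x → ¬ P x) xs → count P? xs ≡ 0
  count-none h = cong length (filter-none P? h)

  count-all : ∀ {xs} → All P xs → count P? xs ≡ length xs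
  count-all h = cong length (filter-all P? h)

  count-concat-replicate : ∀ r xs → count P? (concat (replicate r xs)) ≡ r * count P? xs
  count-concat-replicate zero xs = refl
  count-concat-replicate (suc r) xs =
    trans (count-++ xs _) (cong (count P? xs +_) (count-concat-replicate r xs))

  count-replicate : ∀ r x → count P? (replicate r x) ≡ r * count P? [ x ]
  count-replicate zero x = refl
  count-replicate (suc r) x =
    trans (count-++ [ x ] (replicate r x)) (cong (count P? [ x ] +_) (count-replicate r x))

  count-blowUp : ∀ i bs → count P? (blowUp i bs) ≡ i * count P? bs
  count-blowUp i [] = sym (*-zeroʳ i)
  count-blowUp i (b ∷ bs) = begin
    count P? (replicate i b ++ blowUp i bs)    ≡⟨ count-++ (replicate i b) _ ⟩
    count P? (replicate i b) + count P? (blowUp i bs)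
                                              ≡⟨ cong₂ _+_ (count-replicate i b) (count-blowUp i bs) ⟩
    i * count P? [ b ] + i * count P? bs      ≡⟨ sym (*-distribˡ-+ i (count P? [ b ]) (count P? bs)) ⟩
    i * (count P? [ b ] + count P? bs)        ≡⟨ cong (i *_) (sym (count-++ [ b ] bs)) ⟩
    i * count P? (b ∷ bs)                     ∎
    where open ≡-Reasoning

module _ {A : Set} {P Q : A → Set} (P? : Decidable P) (Q? : Decidable Q) where

  count-ext : ∀ xs → All (λ x → (P x → Q x) × (Q x → P x)) xs → count P? xs ≡ count Q? xs
  count-ext [] [] = refl
  count-ext (x ∷ xs) ((f , g) ∷ h) with P? x | Q? x
  ... | yes _ | yes _ = cong suc (count-ext xs h)
  ... | yes p | no ¬q = ⊥-elim (¬q (f p))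
  ... | no ¬p | yes q = ⊥-elim (¬p (g q))
  ... | no _  | no _  = count-ext xs h

  count-⊎ : ∀ xs → All (λ x → ¬ (P x × Q x)) xs →
            count (λ x → P? x ⊎-dec Q? x) xs ≡ count P? xs + count Q? xs
  count-⊎ [] [] = refl
  count-⊎ (x ∷ xs) (h ∷ hs) with P? x | Q? x
  ... | yes p | yes q = ⊥-elim (h (p , q))
  ... | yes _ | no _  = cong suc (count-⊎ xs hs)
  ... | no _  | yes _ = trans (cong suc (count-⊎ xs hs)) (sym (+-suc _ _))
  ... | no _  | no _  = count-⊎ xs hs

  count-filter : ∀ xs → count Q? (filter P? xs) ≡ count (λ x → P? x ×-dec Q? x) xs
  count-filter [] = refl
  count-filter (x ∷ xs) with P? x
  ... | no _ = count-filter xs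
  ... | yes _ with Q? x
  ...   | yes _ = cong suc (count-filter xs)
  ...   | no _  = count-filter xs

module _ {A B : Set} {P : B → Set} (P? : Decidable P) (f : A → B) where

  count-map : ∀ xs → count P? (map f xs) ≡ count (λ x → P? (f x)) xs
  count-map [] = refl
  count-map (x ∷ xs) with P? (f x)
  ... | yes _ = cong suc (count-map xs)
  ... | no _  = count-map xs

drop-length-++ : {A : Set} (xs ys : List A) → drop (length xs) (xs ++ ys) ≡ ys
drop-length-++ [] ys = refl
drop-length-++ (x ∷ xs) ys = drop-length-++ xs ys

take-length-++ : {A : Set} (xs ys : List A) → take (length xs) (xs ++ ys) ≡ xs
take-length-++ [] ys = refl
take-length-++ (x ∷ xs) ys = cong (x ∷_) (take-length-++ xs ys)

ρ-snoc : {A : Set} (xs : List A) (a : A) → ρ (xs ++ [ a ]) ≡ a ∷ xs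
ρ-snoc xs a rewrite length-++ xs {[ a ]} | m+n∸n≡m (length xs) 1 =
  cong₂ _++_ (drop-length-++ xs [ a ]) (take-length-++ xs [ a ])

length-ρ^ : {A : Set} (i : ℕ) (s : List A) → length (ρ^ i s) ≡ length s
length-ρ^ zero s = refl
length-ρ^ (suc i) s = trans (length-ρ (ρ^ i s)) (length-ρ^ i s)
  where
    length-ρ : ∀ {A : Set} (t : List A) → length (ρ t) ≡ length t
    length-ρ t = begin
      length (drop k t ++ take k t)       ≡⟨ length-++ (drop k t) ⟩
      length (drop k t) + length (take k t) ≡⟨ +-comm (length (drop k t)) _ ⟩
      length (take k t) + length (drop k t) ≡⟨ sym (length-++ (take k t)) ⟩
      length (take k t ++ drop k t)       ≡⟨ cong length (take++drop≡id k t) ⟩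
      length t                            ∎
      where
        open ≡-Reasoning
        k = length t ∸ 1

ρ^-+ : {A : Set} (a b : ℕ) (s : List A) → ρ^ (a + b) s ≡ ρ^ a (ρ^ b s)
ρ^-+ zero b s = refl
ρ^-+ (suc a) b s = cong ρ (ρ^-+ a b s)

ρ^-swap : {A : Set} (X Y : List A) → ρ^ (length Y) (X ++ Y) ≡ Y ++ X
ρ^-swap X [] = ++-identityʳ X
ρ^-swap X (y ∷ Y) = begin
  ρ (ρ^ (length Y) (X ++ y ∷ Y))        ≡⟨ cong (ρ ∘ ρ^ (length Y)) (sym (++-assoc X [ y ] Y)) ⟩
  ρ (ρ^ (length Y) ((X ++ [ y ]) ++ Y)) ≡⟨ cong ρ (ρ^-swap (X ++ [ y ]) Y) ⟩
  ρ (Y ++ X ++ [ y ])                   ≡⟨ cong ρ (sym (++-assoc Y X [ y ])) ⟩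
  ρ ((Y ++ X) ++ [ y ])                 ≡⟨ ρ-snoc (Y ++ X) y ⟩
  y ∷ Y ++ X                            ∎
  where open ≡-Reasoning

ρ^-injective : {A : Set} (i : ℕ) {x y : List A} → ρ^ i x ≡ ρ^ i y → x ≡ y
ρ^-injective zero eq = eq
ρ^-injective (suc i) eq = ρ^-injective i (ρ-injective _ _ eq)
  where
    ρ-injective : ∀ {A : Set} (x y : List A) → ρ x ≡ ρ y → x ≡ y
    ρ-injective x y eq with initLast x | initLast y
    ... | []       | []       = refl
    ... | []       | ys ∷ʳ′ b with () ← trans eq (ρ-snoc ys b)
    ... | xs ∷ʳ′ a | []       with () ← trans (sym (ρ-snoc xs a)) eq
    ... | xs ∷ʳ′ a | ys ∷ʳ′ b
      with refl , refl ← ∷-injective (trans (sym (ρ-snoc xs a)) (trans eq (ρ-snoc ys b))) = refl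

ρ^-periodic : {A : Set} {c : ℕ} {s : List A} → ρ^ c s ≡ s → ∀ t → ρ^ (t * c) s ≡ s
ρ^-periodic eq zero = refl
ρ^-periodic {c = c} {s} eq (suc t) =
  trans (ρ^-+ c (t * c) s) (trans (cong (ρ^ c) (ρ^-periodic eq t)) eq)

period-combination : {A : Set} {s : List A} {g u v : ℕ} → ρ^ u s ≡ s → ρ^ v s ≡ s →
                     ∀ x y → g + y * v ≡ x * u → ρ^ g s ≡ s
period-combination {s = s} {g} {u} {v} eu ev x y eq = begin
  ρ^ g s              ≡⟨ cong (ρ^ g) (sym (ρ^-periodic ev y)) ⟩
  ρ^ g (ρ^ (y * v) s) ≡⟨ sym (ρ^-+ g (y * v) s) ⟩
  ρ^ (g + y * v) s    ≡⟨ cong (λ z → ρ^ z s) eq ⟩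
  ρ^ (x * u) s        ≡⟨ ρ^-periodic eu x ⟩
  s                   ∎
  where open ≡-Reasoning

ρ^-gcd : {A : Set} {s : List A} (a b : ℕ) → ρ^ a s ≡ s → ρ^ b s ≡ s → ρ^ (gcd a b) s ≡ s
ρ^-gcd a b ea eb with Bézout.identity (gcd-GCD a b)
... | Bézout.+- x y eq = period-combination ea eb x y eq
... | Bézout.-+ x y eq = period-combination eb ea y x eq

-- If s has length c·d, is fixed by ρ^c, and d is the order of (s), then c is the least
-- positive period of s: a period p would make n / gcd(p, n) a rotation-invariant divisor,
-- hence at most d, forcing gcd(p, n) ≥ c.
least-period : {A : Set} {s : List A} {c d : ℕ} .{{_ : NonZero d}} → length s ≡ c * d → ρ^ c s ≡ s →
               ((e : ℕ) → RotInvariantDivisor s e → e ≤ d) → ∀ p → 0 < p → ρ^ p s ≡ s → c ≤ p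
least-period {c = zero} _ _ _ _ _ _ = z≤n
least-period {s = s} {c@(suc _)} {d} len≡ ρ^c maximal p 0<p ρ^p = begin
  c                   ≤⟨ *-cancelʳ-≤ c g d (≤-trans (≤-reflexive cd≡g*e) (*-monoʳ-≤ g e≤d)) ⟩
  g                   ≤⟨ ∣⇒≤ {{>-nonZero 0<p}} (gcd[m,n]∣m p n) ⟩
  p                   ∎
  where
    open ≤-Reasoning
    n g e : ℕ
    n = length s
    g = gcd p n
    e = quotient (gcd[m,n]∣n p n)
    ρ^n : ρ^ n s ≡ s
    ρ^n = trans (cong (λ z → ρ^ z s) (trans len≡ (*-comm c d))) (ρ^-periodic ρ^c d)
    n≡e*g : n ≡ e * g
    n≡e*g = _∣_.equality (gcd[m,n]∣n p n)
    n≡g*e : n ≡ g * e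
    n≡g*e = trans n≡e*g (*-comm e g)
    cd≡g*e : c * d ≡ g * e
    cd≡g*e = trans (sym len≡) n≡g*e
    0<e : 0 < e
    0<e with e | n≡e*g
    ... | zero  | n≡0 with () ← m*n≡0⇒m≡0 c d (trans (sym len≡) n≡0)
    ... | suc _ | _   = s≤s z≤n
    e≤d : e ≤ d
    e≤d = maximal e (0<e , g , n≡g*e , ρ^-gcd p n ρ^p ρ^n)

rotations-distinct : {A : Set} {s : List A} {c d : ℕ} .{{_ : NonZero d}} → length s ≡ c * d → ρ^ c s ≡ s →
                     ((e : ℕ) → RotInvariantDivisor s e → e ≤ d) →
                     ∀ {i j} → i < j → j < c → ρ^ i s ≢ ρ^ j s
rotations-distinct {s = s} len≡ ρ^c maximal {i} {j} i<j j<c ρ^i≡ρ^j =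
  <⇒≱ (≤-<-trans (m∸n≤m j i) j<c) (least-period len≡ ρ^c maximal (j ∸ i) (m<n⇒0<n∸m i<j) ρ^[j∸i])
  where
    ρ^[j∸i] : ρ^ (j ∸ i) s ≡ s
    ρ^[j∸i] = ρ^-injective i (begin
      ρ^ i (ρ^ (j ∸ i) s) ≡⟨ sym (ρ^-+ i (j ∸ i) s) ⟩
      ρ^ (i + (j ∸ i)) s  ≡⟨ cong (λ z → ρ^ z s) (m+[n∸m]≡n (<⇒≤ i<j)) ⟩
      ρ^ j s              ≡⟨ sym ρ^i≡ρ^j ⟩
      ρ^ i s              ∎)
      where open ≡-Reasoning

module _ {q : ℕ} where
  private
    module O = DecTotalOrder (lexOrder q)

  infix 4 _⊑_ _⊏_ _<F_ _⊏?_ _<F?_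

  _⊑_ : Word q → Word q → Set
  _⊑_ = O._≤_

  _⊏_ : Word q → Word q → Set
  x ⊏ y = x ⊑ y × x ≢ y

  _<F_ : Fin q → Fin q → Set
  a <F b = a Fin.≤ b × a ≢ b

  _<F?_ : (a b : Fin q) → Dec (a <F b)
  a <F? b = (a Fin.≤? b) ×-dec ¬? (a Fin.≟ b)

  _≟W_ : (x y : Word q) → Dec (x ≡ y)
  _≟W_ = ≡-dec Fin._≟_

  _⊏?_ : (x y : Word q) → Dec (x ⊏ y)
  x ⊏? y = (x O.≤? y) ×-dec ¬? (x ≟W y)

  ⊑-refl : ∀ {x} → x ⊑ x
  ⊑-refl = O.refl

  ⊑-antisym : ∀ {x y} → x ⊑ y → y ⊑ x → x ≡ y
  ⊑-antisym x⊑y y⊑x = Pointwise-≡⇒≡ (O.antisym x⊑y y⊑x)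

  ⊏-irrefl : ∀ {x} → ¬ x ⊏ x
  ⊏-irrefl (_ , x≢x) = x≢x refl

  ⊏-asym : ∀ {x y} → x ⊏ y → ¬ y ⊏ x
  ⊏-asym (x⊑y , x≢y) (y⊑x , _) = x≢y (⊑-antisym x⊑y y⊑x)

  ⊏-⊑-trans : ∀ {x y z} → x ⊏ y → y ⊑ z → x ⊏ z
  ⊏-⊑-trans (x⊑y , x≢y) y⊑z = O.trans x⊑y y⊑z , λ { refl → x≢y (⊑-antisym x⊑y y⊑z) }

  ⊏-head : ∀ {a b u v} → a <F b → a ∷ u ⊏ b ∷ v
  ⊏-head a<b = this a<b , λ { refl → proj₂ a<b refl }

  ⊏-tail : ∀ {a u v} → u ⊏ v → a ∷ u ⊏ a ∷ v
  ⊏-tail (u⊑v , u≢v) = next refl u⊑v , λ { refl → u≢v refl }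

  ⊏-cons⁻ : ∀ {a b u v} → a ∷ u ⊏ b ∷ v → a <F b ⊎ (a ≡ b × u ⊏ v)
  ⊏-cons⁻ (this a<b , _) = inj₁ a<b
  ⊏-cons⁻ (next refl u⊑v , ne) = inj₂ (refl , u⊑v , λ { refl → ne refl })

  ⊑-equal-length : ∀ {u v} → length u ≡ length v → u ⊑ v →
                   u ≡ v ⊎ (∀ t t′ → u ++ t ⊑ v ++ t′)
  ⊑-equal-length {[]} {[]} _ _ = inj₁ refl
  ⊑-equal-length {a ∷ u} {b ∷ v} _ (this a<b) = inj₂ (λ t t′ → this a<b)
  ⊑-equal-length {a ∷ u} {b ∷ v} e (next refl u⊑v) with ⊑-equal-length (suc-injective e) u⊑v
  ... | inj₁ refl = inj₁ refl
  ... | inj₂ ext  = inj₂ (λ t t′ → next refl (ext t t′))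

  -- Appending the same letter to words of equal length neither creates nor breaks order
  -- (needed to compare rotations ρ z = last z ∷ init z).
  ⊑-snoc⁺ : ∀ {u v} (a : Fin q) → length u ≡ length v → u ⊑ v → u ++ [ a ] ⊑ v ++ [ a ]
  ⊑-snoc⁺ a e u⊑v with ⊑-equal-length e u⊑v
  ... | inj₁ refl = ⊑-refl
  ... | inj₂ ext  = ext [ a ] [ a ]

  ⊑-snoc⁻ : ∀ {u v} (a : Fin q) → length u ≡ length v → u ++ [ a ] ⊑ v ++ [ a ] → u ⊑ v
  ⊑-snoc⁻ {[]} {[]} a _ _ = base tt
  ⊑-snoc⁻ {x ∷ u} {y ∷ v} a e (this x<y) = this x<y
  ⊑-snoc⁻ {x ∷ u} {y ∷ v} a e (next x≡y uv) = next x≡y (⊑-snoc⁻ a (suc-injective e) uv)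

  ⊑-take : ∀ K {u v} → u ⊑ v → take K u ⊑ take K v
  ⊑-take zero _ = base tt
  ⊑-take (suc K) (base _) = base tt
  ⊑-take (suc K) halt = halt
  ⊑-take (suc K) (this x<y) = this x<y
  ⊑-take (suc K) (next x≡y uv) = next x≡y (⊑-take K uv)

  ⊑-concat-replicate : ∀ r {u v} → length u ≡ length v → u ⊑ v →
                       concat (replicate r u) ⊑ concat (replicate r v)
  ⊑-concat-replicate zero e u⊑v = base tt
  ⊑-concat-replicate (suc r) {u} {v} e u⊑v with ⊑-equal-length e u⊑v
  ... | inj₁ refl = ⊑-refl
  ... | inj₂ ext  = ext (concat (replicate r u)) (concat (replicate r v))

blowUp-↭ : {A : Set} (d : ℕ) {xs ys : List A} → xs ↭ ys → blowUp d xs ↭ blowUp d ys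
blowUp-↭ d ↭-refl′ = ↭-refl
blowUp-↭ d (prep x p) = ++⁺ˡ (replicate d x) (blowUp-↭ d p)
blowUp-↭ d (swap x y p) =
  ↭-trans (++⁺ˡ (replicate d x) (++⁺ˡ (replicate d y) (blowUp-↭ d p)))
          (shifts (replicate d x) (replicate d y))
blowUp-↭ d (↭-trans′ p p′) = ↭-trans (blowUp-↭ d p) (blowUp-↭ d p′)

concat-replicate-↭-blowUp : {A : Set} (d : ℕ) (xs : List A) → concat (replicate d xs) ↭ blowUp d xs
concat-replicate-↭-blowUp zero [] = ↭-refl
concat-replicate-↭-blowUp zero (x ∷ xs) = concat-replicate-↭-blowUp zero xs
concat-replicate-↭-blowUp (suc d) xs =
  ↭-trans (++⁺ˡ xs (concat-replicate-↭-blowUp d xs)) (one-more-copy xs)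
  where
    one-more-copy : ∀ xs → xs ++ blowUp d xs ↭ blowUp (suc d) xs
    one-more-copy [] = ↭-refl
    one-more-copy (x ∷ xs) =
      prep x (↭-trans (shifts xs (replicate d x)) (++⁺ˡ (replicate d x) (one-more-copy xs)))

AllPairs-blowUp : {A : Set} {R : A → A → Set} → (∀ {x} → R x x) →
                  (d : ℕ) {xs : List A} → AllPairs R xs → AllPairs R (blowUp d xs)
AllPairs-blowUp R-refl d [] = []
AllPairs-blowUp {R = R} R-refl d {x ∷ xs} (x-R-xs ∷ rest) =
  AllPairsP.++⁺ (AllPairs-replicate d) (AllPairs-blowUp R-refl d rest)
                (AllP.replicate⁺ d (All-blowUp d x-R-xs))
  where
    AllPairs-replicate : ∀ d → AllPairs R (replicate d x)
    AllPairs-replicate zero = []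
    AllPairs-replicate (suc d) = AllP.replicate⁺ d R-refl ∷ AllPairs-replicate d
    All-blowUp : ∀ d {ys} → All (R x) ys → All (R x) (blowUp d ys)
    All-blowUp d [] = []
    All-blowUp d (r ∷ rs) = AllP.++⁺ (AllP.replicate⁺ d r) (All-blowUp d rs)

AllPairs-resp-↭ : {A : Set} {R : A → A → Set} → (∀ {x y} → R x y → R y x) →
                  ∀ {xs ys} → xs ↭ ys → AllPairs R xs → AllPairs R ys
AllPairs-resp-↭ R-sym ↭-refl′ rs = rs
AllPairs-resp-↭ R-sym (prep x p) (x-R ∷ rs) = All-resp-↭ p x-R ∷ AllPairs-resp-↭ R-sym p rs
AllPairs-resp-↭ R-sym (swap x y p) ((xy ∷ x-R) ∷ (y-R ∷ rs)) =
  (R-sym xy ∷ All-resp-↭ p y-R) ∷ (All-resp-↭ p x-R ∷ AllPairs-resp-↭ R-sym p rs)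
AllPairs-resp-↭ R-sym (↭-trans′ p p′) rs = AllPairs-resp-↭ R-sym p′ (AllPairs-resp-↭ R-sym p rs)

module _ {q : ℕ} where
  private
    module O = DecTotalOrder (lexOrder q)
  open Sort (lexOrder q) using (sort-↭; sort-↗)

  sortWords-sorted : ∀ ys → AllPairs _⊑_ (sortWords q ys)
  sortWords-sorted ys = Sorted⇒AllPairs O.totalOrder (sort-↗ ys)

  sortWords-↭ : ∀ ys → sortWords q ys ↭ ys
  sortWords-↭ = sort-↭

  sortWords-unique : ∀ {xs ys} → AllPairs _⊑_ xs → xs ↭ ys → sortWords q ys ≡ xs
  sortWords-unique {xs} {ys} sorted xs↭ys =
    Pointwise-≡⇒≡ (PW.map Pointwise-≡⇒≡
      (↗↭↗⇒≋ O.totalOrder (sort-↗ ys) (AllPairs⇒Sorted O.totalOrder sorted)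
        (Homo.map O.Eq.reflexive (↭⇒↭ₛ (↭-trans (sort-↭ ys) (↭-sym xs↭ys))))))

  sortWords-concat-replicate : ∀ d xs → sortWords q (concat (replicate d xs)) ≡ blowUp d (sortWords q xs)
  sortWords-concat-replicate d xs =
    sortWords-unique (AllPairs-blowUp ⊑-refl d (sortWords-sorted xs))
      (↭-trans (blowUp-↭ d (sort-↭ xs)) (↭-sym (concat-replicate-↭-blowUp d xs)))

rotations : {A : Set} → ℕ → List A → List (List A)
rotations c s = applyUpTo (λ i → ρ^ i s) c

applyUpTo-+ : {A : Set} (f : ℕ → A) (a b : ℕ) → applyUpTo f (a + b) ≡ applyUpTo f a ++ applyUpTo (λ i → f (a + i)) b
applyUpTo-+ f zero b = refl
applyUpTo-+ f (suc a) b = cong (f 0 ∷_) (applyUpTo-+ (f ∘ suc) a b)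

applyUpTo-cong : {A : Set} {f g : ℕ → A} → (∀ i → f i ≡ g i) → ∀ n → applyUpTo f n ≡ applyUpTo g n
applyUpTo-cong f≗g zero = refl
applyUpTo-cong f≗g (suc n) = cong₂ _∷_ (f≗g 0) (applyUpTo-cong (f≗g ∘ suc) n)

rotation-table : {A : Set} {s : List A} {c d : ℕ} → length s ≡ c * d → ρ^ c s ≡ s →
                 map (λ i → ρ^ i s) (upTo (length s)) ≡ concat (replicate d (rotations c s))
rotation-table {A} {s} {c} {d} len≡ ρ^c = begin
  map f (upTo (length s)) ≡⟨ map-upTo f (length s) ⟩
  applyUpTo f (length s)  ≡⟨ cong (applyUpTo f) (trans len≡ (*-comm c d)) ⟩
  applyUpTo f (d * c)     ≡⟨ copies d ⟩
  concat (replicate d (rotations c s)) ∎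
  where
    open ≡-Reasoning
    f : ℕ → List A
    f i = ρ^ i s
    f-shift : ∀ i → f (c + i) ≡ f i
    f-shift i = trans (cong (λ z → ρ^ z s) (+-comm c i)) (trans (ρ^-+ i c s) (cong (ρ^ i) ρ^c))
    copies : ∀ t → applyUpTo f (t * c) ≡ concat (replicate t (rotations c s))
    copies zero = refl
    copies (suc t) = trans (applyUpTo-+ f c (t * c))
      (cong (rotations c s ++_) (trans (applyUpTo-cong f-shift (t * c)) (copies t)))

map-ρ-rotations : {A : Set} {s : List A} (c : ℕ) → ρ^ c s ≡ s → map ρ (rotations c s) ↭ rotations c s
map-ρ-rotations zero _ = ↭-refl
map-ρ-rotations {s = s} (suc c) ρ^c = begin
  map ρ (rotations (suc c) s)             ≡⟨ map-applyUpTo (λ i → ρ^ i s) ρ (suc c) ⟩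
  applyUpTo (λ i → ρ^ (suc i) s) (suc c)  ≡⟨ sym (applyUpTo-∷ʳ (λ i → ρ^ (suc i) s) c) ⟩
  later ∷ʳ ρ^ (suc c) s                   ≡⟨ cong (later ∷ʳ_) ρ^c ⟩
  later ∷ʳ s                              ↭⟨ ↭-sym (∷↭∷ʳ s later) ⟩
  s ∷ later                               ∎
  where
    open PermutationReasoning
    later : List (List _)
    later = applyUpTo (λ i → ρ^ (suc i) s) c

rotations-unique : {A : Set} {s : List A} {c d : ℕ} .{{_ : NonZero d}} → length s ≡ c * d → ρ^ c s ≡ s →
                   ((e : ℕ) → RotInvariantDivisor s e → e ≤ d) → AllPairs _≢_ (rotations c s)
rotations-unique len≡ ρ^c maximal =
  AllPairsP.applyUpTo⁺₁ _ _ (rotations-distinct len≡ ρ^c maximal)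

-- The last letter of a word (a default letter stands in for the empty word).
lastOr : {A : Set} → A → List A → A
lastOr d [] = d
lastOr d (x ∷ []) = x
lastOr d (x ∷ y ∷ ys) = lastOr d (y ∷ ys)

lastOr-snoc : {A : Set} (d : A) (xs : List A) (a : A) → lastOr d (xs ++ [ a ]) ≡ a
lastOr-snoc d [] a = refl
lastOr-snoc d (x ∷ []) a = refl
lastOr-snoc d (x ∷ y ∷ xs) a = lastOr-snoc d (y ∷ xs) a

lastL-nonempty : {A : Set} (d : A) (x : List A) → x ≢ [] → lastL x ≡ [ lastOr d x ]
lastL-nonempty d x x≢[] with initLast x
... | [] = ⊥-elim (x≢[] refl)
... | xs ∷ʳ′ a rewrite reverse-++ xs [ a ] | lastOr-snoc d xs a = refl

lastColumn : {A : Set} → List (List A) → List A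
lastColumn = concatMap lastL

lastColumn-blowUp : {A : Set} (d : ℕ) (L : List (List A)) → lastColumn (blowUp d L) ≡ blowUp d (lastColumn L)
lastColumn-blowUp d [] = refl
lastColumn-blowUp d (x ∷ L) = begin
  lastColumn (replicate d x ++ blowUp d L)
    ≡⟨ concatMap-++ lastL (replicate d x) (blowUp d L) ⟩
  concat (map lastL (replicate d x)) ++ lastColumn (blowUp d L)
    ≡⟨ cong₂ _++_ (cong concat (map-replicate lastL d x)) (lastColumn-blowUp d L) ⟩
  concat (replicate d (lastL x)) ++ blowUp d (lastColumn L)
    ≡⟨ cong (_++ blowUp d (lastColumn L)) (copies-of-at-most-one-letter (reverse x)) ⟩
  blowUp d (lastL x) ++ blowUp d (lastColumn L)
    ≡⟨ sym (concatMap-++ (replicate d) (lastL x) (lastColumn L)) ⟩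
  blowUp d (lastL x ++ lastColumn L) ∎
  where
    open ≡-Reasoning
    copies-of-at-most-one-letter : ∀ w → concat (replicate d (take 1 w)) ≡ blowUp d (take 1 w)
    copies-of-at-most-one-letter [] = concat-replicate-[] d
      where
        concat-replicate-[] : ∀ d → concat (replicate d []) ≡ []
        concat-replicate-[] zero = refl
        concat-replicate-[] (suc d) = concat-replicate-[] d
    copies-of-at-most-one-letter (b ∷ _) = trans (concat-replicate-[b] d) (sym (++-identityʳ (replicate d b)))
      where
        concat-replicate-[b] : ∀ d → concat (replicate d [ b ]) ≡ replicate d b
        concat-replicate-[b] zero = refl
        concat-replicate-[b] (suc d) = cong (b ∷_) (concat-replicate-[b] d)

lastColumn-concatMap : {A B : Set} (f : A → List (List B)) (Y : List A) →
                       lastColumn (concatMap f Y) ≡ concat (map (lastColumn ∘ f) Y)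
lastColumn-concatMap f [] = refl
lastColumn-concatMap f (y ∷ Y) =
  trans (concatMap-++ lastL (f y) (concatMap f Y)) (cong (lastColumn (f y) ++_) (lastColumn-concatMap f Y))

module _ {A : Set} (d0 : A) where

  count-lastColumn : {P : A → Set} (P? : Decidable P) (L : List (List A)) → All (_≢ []) L →
                     count P? (lastColumn L) ≡ count (λ x → P? (lastOr d0 x)) L
  count-lastColumn P? [] [] = refl
  count-lastColumn P? (x ∷ L) (x≢[] ∷ L≢[]) rewrite lastL-nonempty d0 x x≢[] with P? (lastOr d0 x)
  ... | yes _ = cong suc (count-lastColumn P? L L≢[])
  ... | no _  = count-lastColumn P? L L≢[]

  length-lastColumn : (L : List (List A)) → All (_≢ []) L → length (lastColumn L) ≡ length L
  length-lastColumn [] [] = refl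
  length-lastColumn (x ∷ L) (x≢[] ∷ L≢[]) rewrite lastL-nonempty d0 x x≢[] =
    cong suc (length-lastColumn L L≢[])

+-multiple-% : (i : ℕ) .{{_ : NonZero i}} (k m : ℕ) → (i * k + m) % i ≡ m % i
+-multiple-% i k m = trans (cong (_% i) (trans (+-comm (i * k) m) (cong (m +_) (*-comm i k))))
                           ([m+kn]%n≡m%n m k i)

length-blowUp : {A : Set} (i : ℕ) (bs : List A) → length (blowUp i bs) ≡ i * length bs
length-blowUp i [] = sym (*-zeroʳ i)
length-blowUp i (b ∷ bs) = begin
  length (replicate i b ++ blowUp i bs)      ≡⟨ length-++ (replicate i b) ⟩
  length (replicate i b) + length (blowUp i bs) ≡⟨ cong₂ _+_ (length-replicate i) (length-blowUp i bs) ⟩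
  i + i * length bs                          ≡⟨ sym (*-suc i (length bs)) ⟩
  i * suc (length bs)                        ∎
  where open ≡-Reasoning

blowUp-prefix : {A : Set} (i : ℕ) (b : A) (rest u : List A) (a : A) (v : List A) →
                replicate i b ++ rest ≡ u ++ a ∷ v →
                (All (_≡ b) u × a ≡ b) ⊎ Σ (List A) (λ u′ → u ≡ replicate i b ++ u′ × rest ≡ u′ ++ a ∷ v)
blowUp-prefix zero b rest u a v eq = inj₂ (u , refl , eq)
blowUp-prefix (suc i) b rest [] a v refl = inj₁ ([] , refl)
blowUp-prefix (suc i) b rest (c ∷ u) a v eq with refl , eq′ ← ∷-injective eq
  with blowUp-prefix i b rest u a v eq′
... | inj₁ (u≡b , a≡b)      = inj₁ (refl ∷ u≡b , a≡b)
... | inj₂ (u′ , u≡ , rest≡) = inj₂ (u′ , cong (b ∷_) u≡ , rest≡)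

blowUp-count-before : {q : ℕ} (i : ℕ) .{{_ : NonZero i}} (a : Fin q) (bs u v : Word q) →
                      blowUp i bs ≡ u ++ a ∷ v → count (Fin._≟ a) u % i ≡ length u % i
blowUp-count-before i a [] [] v ()
blowUp-count-before i a [] (_ ∷ _) v ()
blowUp-count-before i a (b ∷ bs) u v eq with blowUp-prefix i b (blowUp i bs) u a v eq
... | inj₁ (u≡b , refl) = cong (_% i) (count-all (Fin._≟ a) u≡b)
... | inj₂ (u′ , refl , rest≡) = begin
  count a? (replicate i b ++ u′) % i                 ≡⟨ cong (_% i) (count-++ a? (replicate i b) u′) ⟩
  (count a? (replicate i b) + count a? u′) % i       ≡⟨ cong (λ z → (z + count a? u′) % i) (count-replicate a? i b) ⟩
  (i * count a? [ b ] + count a? u′) % i            ≡⟨ +-multiple-% i _ _ ⟩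
  count a? u′ % i                                    ≡⟨ blowUp-count-before i a bs u′ v rest≡ ⟩
  length u′ % i                                      ≡⟨ sym (+-multiple-% i 1 _) ⟩
  (i * 1 + length u′) % i                            ≡⟨ cong (λ z → (z + length u′) % i) (trans (*-identityʳ i) (sym (length-replicate i))) ⟩
  (length (replicate i b) + length u′) % i           ≡⟨ cong (_% i) (sym (length-++ (replicate i b))) ⟩
  length (replicate i b ++ u′) % i                   ∎
  where
    open ≡-Reasoning
    a? : Decidable (_≡ a)
    a? = Fin._≟ a

module _ {q : ℕ} (d0 : Fin q) where
  private
    last : Word q → Fin q
    last = lastOr d0

  ρ-⊏ : ∀ {n} z x → length z ≡ suc n → length x ≡ suc n →
        (ρ z ⊏ ρ x → last z <F last x ⊎ (last z ≡ last x × z ⊏ x)) ×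
        (last z <F last x ⊎ (last z ≡ last x × z ⊏ x) → ρ z ⊏ ρ x)
  ρ-⊏ z x z-len x-len with initLast z | initLast x
  ... | [] | _ with () ← z-len
  ... | _ ∷ʳ′ _ | [] with () ← x-len
  ... | z′ ∷ʳ′ b | x′ ∷ʳ′ a
    rewrite ρ-snoc z′ b | ρ-snoc x′ a | lastOr-snoc d0 z′ b | lastOr-snoc d0 x′ a = to , from
    where
      same-length : length z′ ≡ length x′
      same-length = +-cancelʳ-≡ 1 _ _ (trans (sym (length-++ z′)) (trans z-len (trans (sym x-len) (length-++ x′))))
      to : b ∷ z′ ⊏ a ∷ x′ → b <F a ⊎ (b ≡ a × z′ ++ [ b ] ⊏ x′ ++ [ a ])
      to lt with ⊏-cons⁻ lt
      ... | inj₁ b<a = inj₁ b<a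
      ... | inj₂ (refl , z′⊑x′ , z′≢x′) =
        inj₂ (refl , ⊑-snoc⁺ b same-length z′⊑x′ , λ eq → z′≢x′ (proj₁ (∷ʳ-injective z′ x′ eq)))
      from : b <F a ⊎ (b ≡ a × z′ ++ [ b ] ⊏ x′ ++ [ a ]) → b ∷ z′ ⊏ a ∷ x′
      from (inj₁ b<a) = ⊏-head b<a
      from (inj₂ (refl , zb⊑xb , zb≢xb)) = ⊏-tail (⊑-snoc⁻ b same-length zb⊑xb , λ { refl → zb≢xb refl })

module _ {q : ℕ} where

  count-below : ∀ {Q : Word q → Set} (Q? : Decidable Q) L₁ x L₂ → AllPairs _⊏_ (L₁ ++ x ∷ L₂) →
                count (λ z → Q? z ×-dec z ⊏? x) (L₁ ++ x ∷ L₂) ≡ count Q? L₁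
  count-below Q? [] x L₂ (x⊏L₂ ∷ _) =
    count-none (λ z → Q? z ×-dec z ⊏? x)
      ((λ (_ , x⊏x) → ⊏-irrefl x⊏x) ∷ All.map (λ x⊏z (_ , z⊏x) → ⊏-asym x⊏z z⊏x) x⊏L₂)
  count-below {Q} Q? (y ∷ L₁) x L₂ (y⊏rest ∷ sorted) = begin
    count Q⊏x? (y ∷ L₁ ++ x ∷ L₂)               ≡⟨ count-++ Q⊏x? [ y ] _ ⟩
    count Q⊏x? [ y ] + count Q⊏x? (L₁ ++ x ∷ L₂) ≡⟨ cong₂ _+_ (count-ext Q⊏x? Q? [ y ] ((proj₁ , (_, y⊏x)) ∷ []))
                                                           (count-below Q? L₁ x L₂ sorted) ⟩
    count Q? [ y ] + count Q? L₁                  ≡⟨ sym (count-++ Q? [ y ] L₁) ⟩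
    count Q? (y ∷ L₁)                             ∎
    where
      open ≡-Reasoning
      Q⊏x? : Decidable (λ z → Q z × z ⊏ x)
      Q⊏x? z = Q? z ×-dec z ⊏? x
      y⊏x : y ⊏ x
      y⊏x with AllP.++⁻ʳ L₁ y⊏rest
      ... | y⊏x ∷ _ = y⊏x

  rank-index : ∀ L₁ x L₂ → AllPairs _⊏_ (L₁ ++ x ∷ L₂) → count (_⊏? x) (L₁ ++ x ∷ L₂) ≡ length L₁
  rank-index L₁ x L₂ sorted = begin
    count (_⊏? x) (L₁ ++ x ∷ L₂)
      ≡⟨ count-ext (_⊏? x) (λ z → yes tt ×-dec z ⊏? x) (L₁ ++ x ∷ L₂) (All.tabulate (λ _ → (tt ,_) , proj₂)) ⟩
    count (λ z → yes tt ×-dec z ⊏? x) (L₁ ++ x ∷ L₂) ≡⟨ count-below (λ _ → yes tt) L₁ x L₂ sorted ⟩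
    count (λ _ → yes tt) L₁                            ≡⟨ count-all (λ _ → yes tt) {L₁} (All.tabulate (λ _ → tt)) ⟩
    length L₁                                          ∎
    where open ≡-Reasoning

nonempty-rows : {A : Set} {n : ℕ} {L : List (List A)} → All (λ x → length x ≡ suc n) L → All (_≢ []) L
nonempty-rows [] = []
nonempty-rows {L = (_ ∷ _) ∷ _} (_ ∷ rest) = (λ ()) ∷ nonempty-rows rest

at-least-two : {A : Set} (xs : List A) → 2 ≤ length xs →
               Σ A λ x₀ → Σ A λ x₁ → Σ (List A) λ rest → xs ≡ x₀ ∷ x₁ ∷ rest
at-least-two (x₀ ∷ x₁ ∷ rest) _ = x₀ , x₁ , rest , refl
at-least-two (_ ∷ []) (s≤s ())

-- Rows of the BWT table of a primitive cyclic word: a strictly sorted list L of words of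
-- length n+1 that is closed under ρ.  The rank of ρ x is read off the last column
-- (the LF-mapping of the BWT), which rules out the last column being a blow-up.
module RotationClosed {q : ℕ} (d0 : Fin q) {n : ℕ} (L : List (Word q)) (sorted : AllPairs _⊏_ L)
                      (lengths : All (λ x → length x ≡ suc n) L) (closed : map ρ L ↭ L) where

  private
    last : Word q → Fin q
    last = lastOr d0

  rank : Word q → ℕ
  rank x = count (_⊏? x) L

  count-ρ : ∀ {P : Word q → Set} (P? : Decidable P) → count P? L ≡ count (λ z → P? (ρ z)) L
  count-ρ P? = trans (count-↭ P? (↭-sym closed)) (count-map P? ρ L)

  ρ-∈ : ∀ {x} → x ∈ L → ρ x ∈ L
  ρ-∈ x∈L = ∈-resp-↭ closed (∈-map⁺ ρ x∈L)

  -- LF-mapping: the rows below ρ x are the ρ z with z ending in a smaller letter than x,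
  -- or in the same letter and above x.
  rank-ρ : ∀ L₁ x L₂ → L ≡ L₁ ++ x ∷ L₂ →
           rank (ρ x) ≡ count (λ z → last z <F? last x) L + count (λ z → last z Fin.≟ last x) L₁
  rank-ρ L₁ x L₂ L≡ = begin
    count (_⊏? ρ x) L                       ≡⟨ count-ρ (_⊏? ρ x) ⟩
    count (λ z → ρ z ⊏? ρ x) L              ≡⟨ count-ext _ (λ z → smaller? z ⊎-dec same-below? z) L
                                                   (All.map (λ z-len → ρ-⊏ d0 _ x z-len x-len) lengths) ⟩
    count (λ z → smaller? z ⊎-dec same-below? z) L
                                           ≡⟨ count-⊎ smaller? same-below? L (All.tabulate (λ _ → disjoint)) ⟩
    count smaller? L + count same-below? L ≡⟨ cong (count smaller? L +_) (trans (cong (count same-below?) L≡)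
                                                   (count-below (λ z → last z Fin.≟ last x) L₁ x L₂ (subst (AllPairs _⊏_) L≡ sorted))) ⟩
    count smaller? L + count (λ z → last z Fin.≟ last x) L₁ ∎
    where
      open ≡-Reasoning
      x-len : length x ≡ suc n
      x-len = All.lookup lengths (subst (x ∈_) (sym L≡) (∈-insert L₁))
      smaller? : Decidable (λ z → last z <F last x)
      smaller? z = last z <F? last x
      same-below? : Decidable (λ z → last z ≡ last x × z ⊏ x)
      same-below? z = last z Fin.≟ last x ×-dec z ⊏? x
      disjoint : ∀ {z} → ¬ (last z <F last x × (last z ≡ last x × z ⊏ x))
      disjoint ((_ , ne) , eq , _) = ne eq

  lastColumn-split : ∀ L₁ x L₂ → L ≡ L₁ ++ x ∷ L₂ → lastColumn L ≡ lastColumn L₁ ++ last x ∷ lastColumn L₂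
  lastColumn-split L₁ x L₂ L≡ = begin
    lastColumn L                                      ≡⟨ cong lastColumn L≡ ⟩
    lastColumn (L₁ ++ x ∷ L₂)                         ≡⟨ concatMap-++ lastL L₁ (x ∷ L₂) ⟩
    lastColumn L₁ ++ lastL x ++ lastColumn L₂         ≡⟨ cong (λ w → lastColumn L₁ ++ w ++ lastColumn L₂)
                                                            (lastL-nonempty d0 x (All.lookup (nonempty-rows lengths) x∈L)) ⟩
    lastColumn L₁ ++ last x ∷ lastColumn L₂           ∎
    where
      open ≡-Reasoning
      x∈L : x ∈ L
      x∈L = subst (x ∈_) (sym L≡) (∈-insert L₁)

  -- If the last column is a blow-up by i, then rank (ρ x) ≡ rank x (mod i): the first term
  -- of the LF-mapping counts a blown-up word, the second is x's position mod i.
  rank-ρ-mod : ∀ i .{{_ : NonZero i}} bs → lastColumn L ≡ blowUp i bs →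
               ∀ {x} → x ∈ L → rank (ρ x) % i ≡ rank x % i
  rank-ρ-mod i bs column≡ {x} x∈L with L₁ , L₂ , L≡ ← ∈-∃++ x∈L = begin
    rank (ρ x) % i                                  ≡⟨ cong (_% i) (rank-ρ L₁ _ L₂ L≡) ⟩
    (count smaller? L + count same? L₁) % i         ≡⟨ cong (λ k → (k + count same? L₁) % i) smaller-blown-up ⟩
    (i * count (_<F? last x) bs + count same? L₁) % i ≡⟨ +-multiple-% i _ _ ⟩
    count same? L₁ % i                              ≡⟨ cong (_% i) (sym (count-lastColumn d0 (Fin._≟ last x) L₁ ne₁)) ⟩
    count (Fin._≟ last x) (lastColumn L₁) % i       ≡⟨ blowUp-count-before i (last x) bs _ _
                                                         (trans (sym column≡) (lastColumn-split L₁ _ L₂ L≡)) ⟩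
    length (lastColumn L₁) % i                      ≡⟨ cong (_% i) (length-lastColumn d0 L₁ ne₁) ⟩
    length L₁ % i                                   ≡⟨ cong (_% i) (sym (trans (cong (count (_⊏? _)) L≡)
                                                         (rank-index L₁ _ L₂ (subst (AllPairs _⊏_) L≡ sorted)))) ⟩
    rank x % i                                      ∎
    where
      open ≡-Reasoning
      smaller? : Decidable (λ z → last z <F last x)
      smaller? z = last z <F? last x
      same? : Decidable (λ z → last z ≡ last x)
      same? z = last z Fin.≟ last x
      ne₁ : All (_≢ []) L₁
      ne₁ = AllP.++⁻ˡ L₁ (nonempty-rows (subst (All _) L≡ lengths))
      smaller-blown-up : count smaller? L ≡ i * count (_<F? last x) bs
      smaller-blown-up = begin
        count smaller? L                          ≡⟨ sym (count-lastColumn d0 (_<F? last x) L (nonempty-rows lengths)) ⟩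
        count (_<F? last x) (lastColumn L)         ≡⟨ cong (count (_<F? last x)) column≡ ⟩
        count (_<F? last x) (blowUp i bs)          ≡⟨ count-blowUp (_<F? last x) i bs ⟩
        i * count (_<F? last x) bs                 ∎

  rank-ρ^-mod : ∀ i .{{_ : NonZero i}} bs → lastColumn L ≡ blowUp i bs →
                ∀ {x} → x ∈ L → ∀ p → ρ^ p x ∈ L × rank (ρ^ p x) % i ≡ rank x % i
  rank-ρ^-mod i bs column≡ x∈L zero = x∈L , refl
  rank-ρ^-mod i bs column≡ x∈L (suc p) with ρ^px∈L , ρ^px≡ ← rank-ρ^-mod i bs column≡ x∈L p =
    ρ-∈ ρ^px∈L , trans (rank-ρ-mod i bs column≡ ρ^px∈L) ρ^px≡

  rows-≥ : ∀ i .{{_ : NonZero i}} bs → lastColumn L ≡ blowUp i bs → bs ≢ [] → i ≤ length L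
  rows-≥ i [] column≡ bs≢[] = ⊥-elim (bs≢[] refl)
  rows-≥ i bs@(_ ∷ _) column≡ _ = begin
    i                     ≤⟨ m≤m*n i (length bs) ⟩
    i * length bs         ≡⟨ sym (length-blowUp i bs) ⟩
    length (blowUp i bs)  ≡⟨ cong length (sym column≡) ⟩
    length (lastColumn L) ≡⟨ length-lastColumn d0 L (nonempty-rows lengths) ⟩
    length L              ∎
    where open ≤-Reasoning

  first-two-rows : 2 ≤ length L → Σ (Word q) λ x₀ → Σ (Word q) λ x₁ →
                   (x₀ ∈ L × rank x₀ ≡ 0) × (x₁ ∈ L × rank x₁ ≡ 1)
  first-two-rows 2≤ with at-least-two L 2≤
  ... | x₀ , x₁ , rest , L≡ =
    x₀ , x₁ , (∈-L L≡ (here refl) , rank-at [] x₀ (x₁ ∷ rest) L≡)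
            , (∈-L L≡ (there (here refl)) , rank-at [ x₀ ] x₁ rest L≡)
    where
      ∈-L : ∀ {L′ x} → L ≡ L′ → x ∈ L′ → x ∈ L
      ∈-L L≡ = subst (_ ∈_) (sym L≡)
      rank-at : ∀ L₁ x L₂ → L ≡ L₁ ++ x ∷ L₂ → rank x ≡ length L₁
      rank-at L₁ x L₂ L≡ = trans (cong (count (_⊏? x)) L≡) (rank-index L₁ x L₂ (subst (AllPairs _⊏_) L≡ sorted))

  -- If L is a single orbit {ρ^p s₀}, its last column is not a blow-up by any i > 1:
  -- the rows of rank 0 and 1 would agree mod i.
  lastColumn-not-blowUp : ∀ {s₀} → s₀ ∈ L → (∀ {x} → x ∈ L → Σ ℕ (λ p → x ≡ ρ^ p s₀)) →
                          ∀ i bs → 1 < i → lastColumn L ≢ blowUp i bs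
  lastColumn-not-blowUp _ _ (suc zero) _ (s≤s ())
  lastColumn-not-blowUp {s₀} s₀∈L orbit i@(suc (suc _)) bs _ column≡ =
    ranks-0-and-1-differ (first-two-rows (≤-trans (s≤s (s≤s z≤n)) (rows-≥ i bs column≡ bs≢[])))
    where
      bs≢[] : bs ≢ []
      bs≢[] refl = ∈⇒length≢0 s₀∈L (trans (sym (length-lastColumn d0 L (nonempty-rows lengths))) (cong length column≡))
        where
          ∈⇒length≢0 : ∀ {L′ : List (Word q)} {x} → x ∈ L′ → length L′ ≢ 0
          ∈⇒length≢0 (here _) ()
          ∈⇒length≢0 (there _) ()
      same-class : ∀ {x} → x ∈ L → rank x % i ≡ rank s₀ % i
      same-class x∈L with p , refl ← orbit x∈L = proj₂ (rank-ρ^-mod i bs column≡ s₀∈L p)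
      ranks-0-and-1-differ : ¬ (Σ (Word q) λ x₀ → Σ (Word q) λ x₁ → (x₀ ∈ L × rank x₀ ≡ 0) × (x₁ ∈ L × rank x₁ ≡ 1))
      ranks-0-and-1-differ (x₀ , x₁ , (x₀∈L , rank₀) , (x₁∈L , rank₁)) = 0≢1 (begin
        0 % i        ≡⟨ cong (_% i) (sym rank₀) ⟩
        rank x₀ % i  ≡⟨ same-class x₀∈L ⟩
        rank s₀ % i  ≡⟨ sym (same-class x₁∈L) ⟩
        rank x₁ % i  ≡⟨ cong (_% i) rank₁ ⟩
        1 % i        ∎)
        where
          open ≡-Reasoning
          0≢1 : 0 % i ≢ 1 % i
          0≢1 ()

module _ {q : ℕ} where

  module Fibres (key : Word q → Word q) (Good : Word q → Set)
                (monotone : ∀ {x x′} → Good x → Good x′ → x ⊑ x′ → key x ⊑ key x′) where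

    fibre : List (Word q) → Word q → List (Word q)
    fibre L y = filter (λ x → key x ≟W y) L

    fibres-[] : (Y : List (Word q)) → concatMap (fibre []) Y ≡ []
    fibres-[] [] = refl
    fibres-[] (y ∷ Y) = fibres-[] Y

    fibres-skip : ∀ x L (Y : List (Word q)) → All (key x ≢_) Y → concatMap (fibre (x ∷ L)) Y ≡ concatMap (fibre L) Y
    fibres-skip x L [] [] = refl
    fibres-skip x L (y ∷ Y) (x≢y ∷ rest) =
      cong₂ _++_ (filter-reject (λ z → key z ≟W y) x≢y) (fibres-skip x L Y rest)

    fibres : ∀ (Y L : List (Word q)) → AllPairs _⊏_ Y → AllPairs _⊑_ L → All Good L →
             All (λ x → key x ∈ Y) L → L ≡ concatMap (fibre L) Y
    fibres [] [] _ _ _ _ = refl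
    fibres [] (x ∷ L) _ _ _ (() ∷ _)
    fibres (y ∷ Y) [] _ _ _ _ = sym (fibres-[] Y)
    fibres (y ∷ Y) (x ∷ L) (y⊏Y ∷ Y-sorted) (x⊑L ∷ L-sorted) (good-x ∷ good-L) (kx∈ ∷ kL∈) =
      by-cases (key x ≟W y) (fibres (y ∷ Y) L (y⊏Y ∷ Y-sorted) L-sorted good-L kL∈)
        (λ kx∈Y kL∈Y → fibres Y (x ∷ L) Y-sorted (x⊑L ∷ L-sorted) (good-x ∷ good-L) (kx∈Y ∷ kL∈Y))
      where
        open ≡-Reasoning
        by-cases : Dec (key x ≡ y) → L ≡ concatMap (fibre L) (y ∷ Y) →
                   (key x ∈ Y → All (λ z → key z ∈ Y) L → x ∷ L ≡ concatMap (fibre (x ∷ L)) Y) →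
                   x ∷ L ≡ concatMap (fibre (x ∷ L)) (y ∷ Y)
        -- x opens the fibre of y, and belongs to no later fibre.
        by-cases (yes kx≡y) split-L _ = begin
          x ∷ L                                           ≡⟨ cong (x ∷_) split-L ⟩
          x ∷ (fibre L y ++ concatMap (fibre L) Y)        ≡⟨ cong (λ w → x ∷ (fibre L y ++ w)) (sym (fibres-skip x L Y x≢Y)) ⟩
          x ∷ (fibre L y ++ concatMap (fibre (x ∷ L)) Y)  ≡⟨ cong (_++ concatMap (fibre (x ∷ L)) Y)
                                                                (sym (filter-accept (λ z → key z ≟W y) kx≡y)) ⟩
          fibre (x ∷ L) y ++ concatMap (fibre (x ∷ L)) Y  ∎
          where
            x≢Y : All (key x ≢_) Y
            x≢Y = All.map (λ (_ , y≢y′) kx≡y′ → y≢y′ (trans (sym kx≡y) kx≡y′)) y⊏Y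
        -- The fibre of y is empty: every key of x ∷ L lies strictly above y.
        by-cases (no kx≢y) _ split-x∷L = begin
          x ∷ L                                           ≡⟨ split-x∷L kx∈Y kL∈Y ⟩
          concatMap (fibre (x ∷ L)) Y                     ≡⟨ cong (_++ concatMap (fibre (x ∷ L)) Y)
                                                                (sym (filter-none (λ z → key z ≟W y) (kx≢y ∷ kL≢y))) ⟩
          fibre (x ∷ L) y ++ concatMap (fibre (x ∷ L)) Y  ∎
          where
            kx∈Y : key x ∈ Y
            kx∈Y = drop-head kx∈
              where
                drop-head : key x ∈ y ∷ Y → key x ∈ Y
                drop-head (here kx≡y) = ⊥-elim (kx≢y kx≡y)
                drop-head (there kx∈Y) = kx∈Y
            y⊏kL : All (λ z → y ⊏ key z) L
            y⊏kL = All.zipWith (λ (x⊑z , good-z) → ⊏-⊑-trans (All.lookup y⊏Y kx∈Y) (monotone good-x good-z x⊑z))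
                               (x⊑L , good-L)
            kL≢y : All (λ z → key z ≢ y) L
            kL≢y = All.map (λ y⊏kz kz≡y → proj₂ y⊏kz (sym kz≡y)) y⊏kL
            kL∈Y : All (λ z → key z ∈ Y) L
            kL∈Y = All.zipWith (λ { (here kz≡y , kz≢y) → ⊥-elim (kz≢y kz≡y) ; (there kz∈Y , _) → kz∈Y }) (kL∈ , kL≢y)

  wordsOfLength : ℕ → List (Word q)
  wordsOfLength zero = [ [] ]
  wordsOfLength (suc j) = concatMap (λ a → map (a ∷_) (wordsOfLength j)) (allFin q)

  wordsOfLength-lengths : ∀ j → All (λ w → length w ≡ j) (wordsOfLength j)
  wordsOfLength-lengths zero = refl ∷ []
  wordsOfLength-lengths (suc j) =
    AllP.concat⁺ (AllP.map⁺ (All.tabulate {xs = allFin q} (λ {a} _ →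
      AllP.map⁺ {f = a ∷_} (All.map (cong suc) (wordsOfLength-lengths j)))))

  length-wordsOfLength : ∀ j → length (wordsOfLength j) ≡ q ^ j
  length-wordsOfLength zero = refl
  length-wordsOfLength (suc j) = trans (length-concat-equal (allFin q)) (cong (_* q ^ j) (length-allFin q))
    where
      length-concat-equal : ∀ (as : List (Fin q)) → length (concatMap (λ a → map (a ∷_) (wordsOfLength j)) as) ≡ length as * q ^ j
      length-concat-equal [] = refl
      length-concat-equal (a ∷ as) = trans (length-++ (map (a ∷_) (wordsOfLength j)))
        (cong₂ _+_ (trans (length-map (a ∷_) (wordsOfLength j)) (length-wordsOfLength j)) (length-concat-equal as))
      length-allFin : ∀ n → length (allFin n) ≡ n
      length-allFin n = length-tabulate {n = n} (λ a → a)

  ∈-wordsOfLength : ∀ j (w : Word q) → length w ≡ j → w ∈ wordsOfLength j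
  ∈-wordsOfLength zero [] _ = here refl
  ∈-wordsOfLength (suc j) (a ∷ w) len≡ =
    ∈-concat⁺′ (∈-map⁺ (a ∷_) (∈-wordsOfLength j w (suc-injective len≡)))
               (∈-map⁺ (λ a → map (a ∷_) (wordsOfLength j)) (∈-allFin a))

  wordsOfLength-sorted : ∀ j → AllPairs _⊏_ (wordsOfLength j)
  wordsOfLength-sorted zero = [] ∷ []
  wordsOfLength-sorted (suc j) =
    AllPairsP.concat⁺ (AllP.map⁺ (All.tabulate (λ _ → AllPairsP.map⁺ (same-head (wordsOfLength-sorted j)))))
                      (AllPairsP.map⁺ (AllPairsP.tabulate⁺-< (λ a<b →
                         AllP.map⁺ (All.tabulate (λ _ → AllP.map⁺ (All.tabulate (λ _ →
                           ⊏-head (<⇒≤ a<b , FinP.<⇒≢ a<b))))))))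
    where
      same-head : ∀ {a} {ws : List (Word q)} → AllPairs _⊏_ ws → AllPairs (λ u v → a ∷ u ⊏ a ∷ v) ws
      same-head [] = []
      same-head (u⊏ws ∷ rest) = All.map ⊏-tail u⊏ws ∷ same-head rest

-- The first K letters of the periodic word x x x ⋯ (K + 1 copies of x suffice).
cyclicPrefix : {A : Set} → ℕ → List A → List A
cyclicPrefix K x = take K (concat (replicate (suc K) x))

length-concat-replicate : {A : Set} (r : ℕ) (x : List A) → length (concat (replicate r x)) ≡ r * length x
length-concat-replicate zero x = refl
length-concat-replicate (suc r) x = trans (length-++ x) (cong (length x +_) (length-concat-replicate r x))

≤-length-copies : {A : Set} (K : ℕ) (x : List A) → 0 < length x → K ≤ length (concat (replicate (suc K) x))
≤-length-copies K x 0<|x| = begin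
  K                                    ≤⟨ n≤1+n K ⟩
  suc K                                ≤⟨ m≤m*n (suc K) (length x) {{>-nonZero 0<|x|}} ⟩
  suc K * length x                     ≡⟨ sym (length-concat-replicate (suc K) x) ⟩
  length (concat (replicate (suc K) x)) ∎
  where open ≤-Reasoning

length-cyclicPrefix : {A : Set} (K : ℕ) (x : List A) → 0 < length x → length (cyclicPrefix K x) ≡ K
length-cyclicPrefix K x 0<|x| = trans (length-take K _) (m≤n⇒m⊓n≡m (≤-length-copies K x 0<|x|))

take-++-≤ : {A : Set} (K : ℕ) (X Y : List A) → K ≤ length X → take K (X ++ Y) ≡ take K X
take-++-≤ zero X Y _ = refl
take-++-≤ (suc K) (x ∷ X) Y (s≤s K≤) = cong (x ∷_) (take-++-≤ K X Y K≤)

cyclicPrefix-rotate : {A : Set} (K : ℕ) (a : A) (Z : List A) →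
                      cyclicPrefix (suc K) (a ∷ Z) ≡ a ∷ cyclicPrefix K (Z ++ [ a ])
cyclicPrefix-rotate {A} K a Z =
  cong (a ∷_) (trans (cong (take K) (shift (suc K)))
                     (take-++-≤ K _ Z (≤-length-copies K (Z ++ [ a ]) 0<|Za|)))
  where
    copies : ℕ → List A → List A
    copies r x = concat (replicate r x)
    shift : ∀ r → Z ++ copies r (a ∷ Z) ≡ copies r (Z ++ [ a ]) ++ Z
    shift zero = ++-identityʳ Z
    shift (suc r) = begin
      Z ++ (a ∷ Z) ++ copies r (a ∷ Z)          ≡⟨ sym (++-assoc Z [ a ] _) ⟩
      (Z ++ [ a ]) ++ Z ++ copies r (a ∷ Z)     ≡⟨ cong ((Z ++ [ a ]) ++_) (shift r) ⟩
      (Z ++ [ a ]) ++ copies r (Z ++ [ a ]) ++ Z ≡⟨ sym (++-assoc (Z ++ [ a ]) _ Z) ⟩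
      copies (suc r) (Z ++ [ a ]) ++ Z           ∎
      where open ≡-Reasoning
    0<|Za| : 0 < length (Z ++ [ a ])
    0<|Za| = subst (0 <_) (sym (trans (length-++ Z) (+-comm (length Z) 1))) (s≤s z≤n)

split-at : {A : Set} (s : List A) (t : ℕ) → t < length s →
           Σ (List A) λ u → Σ A λ a → Σ (List A) λ w → s ≡ u ++ a ∷ w × length u ≡ t
split-at (x ∷ s) zero _ = [] , x , s , refl , refl
split-at (x ∷ s) (suc t) (s≤s t<n) with u , a , w , refl , refl ← split-at s t t<n = x ∷ u , a , w , refl , refl

module _ {A : Set} (d0 : A) (K : ℕ) where

  cyclicWindow : List A → List A
  cyclicWindow x = lastOr d0 x ∷ cyclicPrefix K x

  window-rotation : (s : List A) (t : ℕ) → t < length s →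
                    window s (suc K) t ≡ cyclicWindow (ρ^ (length s ∸ suc t) s)
  window-rotation s t t<n with u , a , w , refl , refl ← split-at s t t<n = begin
    take (suc K) (concat (replicate (suc (suc K)) (drop (length u) s ++ take (length u) s)))
      ≡⟨ cong₂ (λ p r → cyclicPrefix (suc K) (p ++ r)) (drop-length-++ u (a ∷ w)) (take-length-++ u (a ∷ w)) ⟩
    cyclicPrefix (suc K) (a ∷ w ++ u)                         ≡⟨ cyclicPrefix-rotate K a (w ++ u) ⟩
    a ∷ cyclicPrefix K ((w ++ u) ++ [ a ])                    ≡⟨ cong (_∷ cyclicPrefix K ((w ++ u) ++ [ a ])) (sym (lastOr-snoc d0 (w ++ u) a)) ⟩
    cyclicWindow ((w ++ u) ++ [ a ])                          ≡⟨ cong cyclicWindow (sym rotation) ⟩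
    cyclicWindow (ρ^ (length s ∸ suc (length u)) s)          ∎
    where
      open ≡-Reasoning
      rotation : ρ^ (length (u ++ a ∷ w) ∸ suc (length u)) (u ++ a ∷ w) ≡ (w ++ u) ++ [ a ]
      rotation = begin
        ρ^ (length (u ++ a ∷ w) ∸ suc (length u)) (u ++ a ∷ w)
          ≡⟨ cong (λ z → ρ^ z (u ++ a ∷ w)) (trans (cong (_∸ suc (length u)) (trans (length-++ u) (+-suc (length u) (length w))))
                                                    (m+n∸m≡n (length u) (length w))) ⟩
        ρ^ (length w) (u ++ a ∷ w)         ≡⟨ cong (ρ^ (length w)) (sym (++-assoc u [ a ] w)) ⟩
        ρ^ (length w) ((u ++ [ a ]) ++ w)  ≡⟨ ρ^-swap (u ++ [ a ]) w ⟩
        w ++ u ++ [ a ]                    ≡⟨ sym (++-assoc w u [ a ]) ⟩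
        (w ++ u) ++ [ a ]                  ∎

sum-map-+ : {A : Set} (f g : A → ℕ) (xs : List A) →
            sum (map (λ x → f x + g x) xs) ≡ sum (map f xs) + sum (map g xs)
sum-map-+ f g [] = refl
sum-map-+ f g (x ∷ xs) =
  trans (cong (f x + g x +_) (sum-map-+ f g xs)) (+-interchange (f x) (g x) _ _)
  where open CommutativeSemigroupProperties +-commutativeSemigroup using () renaming (interchange to +-interchange)

sum-map-const : {A : Set} (c : ℕ) (f : A → ℕ) (xs : List A) → All (λ x → f x ≡ c) xs → sum (map f xs) ≡ length xs * c
sum-map-const c f [] [] = refl
sum-map-const c f (x ∷ xs) (fx≡c ∷ rest) = cong₂ _+_ fx≡c (sum-map-const c f xs rest)

map-allFin-suc : {A : Set} {q : ℕ} (h : Fin (suc q) → A) → map h (allFin (suc q)) ≡ h Fin.zero ∷ map (h ∘ Fin.suc) (allFin q)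
map-allFin-suc {q = q} h = cong (h Fin.zero ∷_) (trans (map-tabulate Fin.suc h) (sym (map-tabulate (λ a → a) (h ∘ Fin.suc))))

sum-indicator : ∀ q (b : Fin q) → sum (map (λ a → countL a [ b ]) (allFin q)) ≡ 1
sum-indicator (suc q) b = trans (cong sum (map-allFin-suc (λ a → countL a [ b ]))) (split b)
  where
    split : (b : Fin (suc q)) → countL Fin.zero [ b ] + sum (map (λ a → countL (Fin.suc a) [ b ]) (allFin q)) ≡ 1
    split Fin.zero = cong suc (trans (sum-map-const 0 _ (allFin q) (All.tabulate (λ _ → refl))) (*-zeroʳ (length (allFin q))))
    split (Fin.suc b) = trans (cong sum (map-cong shift (allFin q))) (sum-indicator q b)
      where
        shift : ∀ a → countL (Fin.suc a) [ Fin.suc b ] ≡ countL a [ b ]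
        shift a with b Fin.≟ a
        ... | yes _ = refl
        ... | no _  = refl

sum-letter-counts : ∀ {q} (w : Word q) → sum (map (λ a → countL a w) (allFin q)) ≡ length w
sum-letter-counts {q} [] = trans (sum-map-const 0 _ (allFin q) (All.tabulate (λ _ → refl))) (*-zeroʳ (length (allFin q)))
sum-letter-counts {q} (b ∷ w) = begin
  sum (map (λ a → countL a (b ∷ w)) (allFin q))
    ≡⟨ cong sum (map-cong (λ a → count-++ (Fin._≟ a) [ b ] w) (allFin q)) ⟩
  sum (map (λ a → countL a [ b ] + countL a w) (allFin q))
    ≡⟨ sum-map-+ (λ a → countL a [ b ]) (λ a → countL a w) (allFin q) ⟩
  sum (map (λ a → countL a [ b ]) (allFin q)) + sum (map (λ a → countL a w) (allFin q))
    ≡⟨ cong₂ _+_ (sum-indicator q b) (sum-letter-counts w) ⟩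
  suc (length w) ∎
  where open ≡-Reasoning

InP-from-counts : ∀ {q} m′ (w : Word q) → ((a : Fin q) → countL a w ≡ m′) → InP m′ q w
InP-from-counts {q} m′ w counts = length≡ , counts
  where
    length≡ : length w ≡ m′ * q
    length≡ = begin
      length w                                       ≡⟨ sym (sum-letter-counts w) ⟩
      sum (map (λ a → countL a w) (allFin q))         ≡⟨ sum-map-const m′ _ (allFin q) (All.tabulate (λ {a} _ → counts a)) ⟩
      length (allFin q) * m′                          ≡⟨ cong (_* m′) (length-tabulate {n = q} (λ a → a)) ⟩
      q * m′                                         ≡⟨ *-comm q m′ ⟩
      m′ * q                                         ∎
      where open ≡-Reasoning

reversed-positions : ∀ n → map (λ t → n ∸ suc t) (upTo n) ↭ upTo n
reversed-positions n = begin
  map (λ t → n ∸ suc t) (upTo n)    ≡⟨ map-upTo _ n ⟩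
  applyUpTo (λ t → n ∸ suc t) n     ≡⟨ down n ⟩
  downFrom n                        ≡⟨ sym (reverse-upTo n) ⟩
  reverse (upTo n)                  ↭⟨ ↭-reverse (upTo n) ⟩
  upTo n                            ∎
  where
    open PermutationReasoning
    down : ∀ n → applyUpTo (λ t → n ∸ suc t) n ≡ downFrom n
    down zero = refl
    down (suc n) = cong (n ∷_) (down n)

toVec : {A : Set} (xs : List A) (N : ℕ) → length xs ≡ N → Σ (Vec A N) (λ v → toList v ≡ xs)
toVec [] zero _ = Vec.[] , refl
toVec (x ∷ xs) (suc N) len≡ with v , v≡ ← toVec xs N (suc-injective len≡) = x Vec.∷ v , cong (x ∷_) v≡

-- The BWT of a cyclic word s of order d with |s| = c·d, c = c′ + 1, whose rows are words
-- of length n + 1.  Its sorted table is d copies of each of the c distinct rotations, so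
-- BWT(s) = column^d for the last column of the c sorted distinct rotations.
module BWTOfOrder {q : ℕ} (d0 : Fin q) {n c′ d : ℕ} .{{_ : NonZero d}} (s : Word q)
                  (length-s : length s ≡ suc n) (length≡ : length s ≡ suc c′ * d)
                  (periodic : ρ^ (suc c′) s ≡ s) (maximal : (e : ℕ) → RotInvariantDivisor s e → e ≤ d) where

  rows : List (Word q)
  rows = rotations (suc c′) s

  L : List (Word q)
  L = sortWords q rows

  column : Word q
  column = lastColumn L

  L↭rows : L ↭ rows
  L↭rows = sortWords-↭ rows

  BWT-blowUp : BWT s ≡ blowUp d column
  BWT-blowUp = begin
    lastColumn (sortWords q (map (λ i → ρ^ i s) (upTo (length s))))
      ≡⟨ cong (lastColumn ∘ sortWords q) (rotation-table {c = suc c′} {d} length≡ periodic) ⟩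
    lastColumn (sortWords q (concat (replicate d rows))) ≡⟨ cong lastColumn (sortWords-concat-replicate d rows) ⟩
    lastColumn (blowUp d L)                             ≡⟨ lastColumn-blowUp d L ⟩
    blowUp d column                                     ∎
    where open ≡-Reasoning

  lengths : All (λ x → length x ≡ suc n) L
  lengths = All-resp-↭ (↭-sym L↭rows) (AllP.applyUpTo⁺₂ (λ i → ρ^ i s) (suc c′) (λ i → trans (length-ρ^ i s) length-s))

  strictly-sorted : AllPairs _⊏_ L
  strictly-sorted = AllPairs.zipWith id
    (sortWords-sorted rows , AllPairs-resp-↭ (λ x≢y y≡x → x≢y (sym y≡x)) (↭-sym L↭rows)
                                             (rotations-unique {c = suc c′} {d} length≡ periodic maximal))

  ρ-closed : map ρ L ↭ L
  ρ-closed = ↭-trans (map⁺ ρ L↭rows) (↭-trans (map-ρ-rotations (suc c′) periodic) (↭-sym L↭rows))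

  s∈L : s ∈ L
  s∈L = ∈-resp-↭ (↭-sym L↭rows) (here refl)

  orbit : ∀ {x} → x ∈ L → Σ ℕ (λ p → x ≡ ρ^ p s)
  orbit x∈L with p , _ , x≡ ← ∈-applyUpTo⁻ (λ i → ρ^ i s) (∈-resp-↭ L↭rows x∈L) = p , x≡

  column-∈𝒩 : InN column
  column-∈𝒩 = nonempty , λ (i , 1<i , bs , column≡) → lastColumn-not-blowUp s∈L orbit i bs 1<i column≡
    where
      open RotationClosed d0 L strictly-sorted lengths ρ-closed using (lastColumn-not-blowUp)
      nonempty : column ≢ []
      nonempty column≡[] with () ← trans (sym (cong length column≡[]))
        (trans (length-lastColumn d0 L (nonempty-rows lengths))
               (trans (↭-length L↭rows) (length-applyUpTo (λ i → ρ^ i s) (suc c′))))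

  -- The column splits into q^(k-1) blocks, one per (k-1)-mer y: the last letters of the rows
  -- whose periodic extension starts with y.  In a multi de Bruijn sequence each letter a
  -- occurs m/d times in block y, since the rows with window a y correspond to the
  -- occurrences of the k-mer a y in (s), each counted d times.
  module Blocks {m K : ℕ} (deBruijn : IsMultiDeBruijn m q (suc K) s) where

    key : Word q → Word q
    key = cyclicPrefix K

    key-monotone : ∀ {x x′} → length x ≡ suc n → length x′ ≡ suc n → x ⊑ x′ → key x ⊑ key x′
    key-monotone x-len x′-len x⊑x′ = ⊑-take K (⊑-concat-replicate (suc K) (trans x-len (sym x′-len)) x⊑x′)

    open Fibres key (λ x → length x ≡ suc n) key-monotone

    length-key : ∀ {x} → length x ≡ suc n → length (key x) ≡ K
    length-key {x} x-len = length-cyclicPrefix K x (subst (0 <_) (sym x-len) (s≤s z≤n))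

    block : Word q → Word q
    block y = lastColumn (fibre L y)

    column-blocks : column ≡ concat (map block (wordsOfLength K))
    column-blocks = trans (cong lastColumn L-fibres) (lastColumn-concatMap (fibre L) (wordsOfLength K))
      where
        L-fibres : L ≡ concatMap (fibre L) (wordsOfLength K)
        L-fibres = fibres (wordsOfLength K) L (wordsOfLength-sorted K) (sortWords-sorted rows) lengths
                          (All.map (λ x-len → ∈-wordsOfLength K _ (length-key x-len)) lengths)

    -- Rows of L whose window (last letter, then the first K letters) is the k-mer w.
    rowsWithWindow : Word q → ℕ
    rowsWithWindow w = count (λ x → cyclicWindow d0 K x ≟W w) L

    -- Every occurrence of a k-mer in (s) is the window of a rotation, and the n rotations
    -- are d copies of the rows.
    occ≡rows : (w : Word q) (v : Vec (Fin q) (suc K)) → toList v ≡ w → occ s (suc K) v ≡ d * rowsWithWindow w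
    occ≡rows w v v≡w = begin
      count (λ t → window s (suc K) t ≟W toList v) (upTo N)
        ≡⟨ count-ext _ (λ t → window s (suc K) t ≟W w) (upTo N) (All.tabulate (λ _ → (λ e → trans e v≡w) , (λ e → trans e (sym v≡w)))) ⟩
      count (λ t → window s (suc K) t ≟W w) (upTo N)
        ≡⟨ count-ext _ (λ t → window-of (N ∸ suc t) ≟W w) (upTo N)
                     (All.map (λ t<N → (trans (sym (window-rotation d0 K s _ t<N))) , trans (window-rotation d0 K s _ t<N)) (all-upTo N)) ⟩
      count (λ t → window-of (N ∸ suc t) ≟W w) (upTo N)      ≡⟨ sym (count-map (λ i → window-of i ≟W w) (λ t → N ∸ suc t) (upTo N)) ⟩
      count (λ i → window-of i ≟W w) (map (λ t → N ∸ suc t) (upTo N))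
                                                             ≡⟨ count-↭ (λ i → window-of i ≟W w) (reversed-positions N) ⟩
      count (λ i → window-of i ≟W w) (upTo N)                ≡⟨ sym (count-map has-w? (λ i → ρ^ i s) (upTo N)) ⟩
      count has-w? (map (λ i → ρ^ i s) (upTo N))             ≡⟨ cong (count has-w?) (rotation-table {c = suc c′} {d} length≡ periodic) ⟩
      count has-w? (concat (replicate d rows))              ≡⟨ count-concat-replicate has-w? d rows ⟩
      d * count has-w? rows                                 ≡⟨ cong (d *_) (count-↭ has-w? (↭-sym L↭rows)) ⟩
      d * rowsWithWindow w                                  ∎
      where
        open ≡-Reasoning
        N : ℕ
        N = length s
        window-of : ℕ → Word q
        window-of i = cyclicWindow d0 K (ρ^ i s)
        has-w? : Decidable (λ x → cyclicWindow d0 K x ≡ w)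
        has-w? x = cyclicWindow d0 K x ≟W w

    count-block : (a : Fin q) (y : Word q) → countL a (block y) ≡ rowsWithWindow (a ∷ y)
    count-block a y = begin
      count (Fin._≟ a) (lastColumn (fibre L y))
        ≡⟨ count-lastColumn d0 (Fin._≟ a) (fibre L y) (AllP.filter⁺ (λ x → key x ≟W y) (nonempty-rows lengths)) ⟩
      count (λ x → lastOr d0 x Fin.≟ a) (fibre L y)
        ≡⟨ count-filter (λ x → key x ≟W y) (λ x → lastOr d0 x Fin.≟ a) L ⟩
      count (λ x → key x ≟W y ×-dec lastOr d0 x Fin.≟ a) L
        ≡⟨ count-ext _ (λ x → cyclicWindow d0 K x ≟W (a ∷ y)) L (All.tabulate (λ _ → to , from)) ⟩
      rowsWithWindow (a ∷ y) ∎
      where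
        open ≡-Reasoning
        to : ∀ {x} → key x ≡ y × lastOr d0 x ≡ a → cyclicWindow d0 K x ≡ a ∷ y
        to (key≡ , last≡) = cong₂ _∷_ last≡ key≡
        from : ∀ {x} → cyclicWindow d0 K x ≡ a ∷ y → key x ≡ y × lastOr d0 x ≡ a
        from eq with last≡ , key≡ ← ∷-injective eq = key≡ , last≡

    block-∈𝒫 : ∀ y → length y ≡ K → InP (m / d) q (block y)
    block-∈𝒫 y y-len = InP-from-counts (m / d) (block y) λ a → trans (count-block a y) (rows≡ a)
      where
        rows≡ : ∀ a → rowsWithWindow (a ∷ y) ≡ m / d
        rows≡ a with v , v≡ ← toVec (a ∷ y) (suc K) (cong suc y-len) = sym (begin
          m / d                            ≡⟨ cong (_/ d) (sym (deBruijn v)) ⟩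
          occ s (suc K) v / d              ≡⟨ cong (_/ d) (trans (occ≡rows (a ∷ y) v v≡) (*-comm d _)) ⟩
          rowsWithWindow (a ∷ y) * d / d   ≡⟨ m*n/n≡m (rowsWithWindow (a ∷ y)) d ⟩
          rowsWithWindow (a ∷ y)           ∎)
          where open ≡-Reasoning

    column-∈𝒫 : InPPow (m / d) q (q ^ K) column
    column-∈𝒫 with bs , bs≡ ← toVec (map block (wordsOfLength K)) (q ^ K)
                                    (trans (length-map block (wordsOfLength K)) (length-wordsOfLength K)) =
      bs , subst (All (InP (m / d) q)) (sym bs≡) (AllP.map⁺ (All.map (λ {y} → block-∈𝒫 y) (wordsOfLength-lengths K))) ,
      trans (cong concat bs≡) (sym column-blocks)

-- The degenerate cases are impossible: an empty s
-- has no k-mer occurrences although m ≥ 1, and a nonempty s cannot have length 0 · d.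
theorem9 : (m q k d : ℕ) .{{_ : NonZero d}} → 1 ≤ m → 1 ≤ q → 1 ≤ k → d ∣ m →
    (s : Word q) → InC d m q k s →
    Σ (Word q) (λ as → BWT s ≡ blowUp d as × InPPow (m / d) q (q ^ (k ∸ 1)) as × InN as)
theorem9 m (suc _) (suc K) d m≥1 (s≤s z≤n) (s≤s z≤n) _ [] (deBruijn , _) =
  ⊥-elim (<⇒≢ m≥1 (deBruijn (Vec.replicate (suc K) Fin.zero)))
theorem9 m (suc _) (suc K) d _ (s≤s z≤n) (s≤s z≤n) _ (_ ∷ _) (_ , (_ , zero , () , _) , _)
theorem9 m (suc _) (suc K) d _ (s≤s z≤n) (s≤s z≤n) _ s@(_ ∷ s′) (deBruijn , (_ , suc c′ , length≡ , periodic) , maximal) =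
  column , BWT-blowUp , column-∈𝒫 , column-∈𝒩
  where
    open BWTOfOrder Fin.zero {n = length s′} {c′} s refl length≡ periodic maximal
    open Blocks deBruijn
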